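{- There is a constant $c>0$ such that for every $n\ge 3$, every closed RI drawing of the $n$-vertex star $K_{1,n-1}$ with vertices at integer coordinates lies on a grid of size $W\times H$ with $W\cdot H\ge c\,n^2$.
   Context: A closed rectangle-of-influence (closed RI) drawing of a graph is a planar straight-line drawing (vertices at distinct points, edges as straight-line segments, no two edges intersecting except at common endpoints) such that for every edge $(u,v)$, the closed axis-parallel rectangle having the points of $u$ and $v$ as opposite corners contains no vertex other than $u$ and $v$. A drawing is on a grid of size $W\times H$ if the minimum axis-aligned box containing all vertex points has side lengths $W-1$ and $H-1$. -}

module Defs where

open import Data.Nat as ℕ using (ℕ; zero; suc)
open import Data.Integer as ℤ using (ℤ)
open import Data.Rational as ℚ using (ℚ; 0ℚ; 1ℚ)
open import Data.Fin using (Fin; toℕ)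
import Data.Fin as Fin
open import Data.Product using (_×_; _,_; ∃; ∃-syntax; proj₁; proj₂)
open import Data.Sum using (_⊎_)
open import Relation.Binary.PropositionalEquality using (_≡_; _≢_)
open import Relation.Nullary using (¬_)
open import Function.Definitions using (Injective)

record Graph (n : ℕ) : Set₁ where
  field
    Edge : Fin n → Fin n → Set

Star : (n : ℕ) → Graph n
Star n = record { Edge = λ u v → (toℕ u ≡ 0 × toℕ v ≢ 0) ⊎ (toℕ v ≡ 0 × toℕ u ≢ 0) }

Point : Set
Point = ℤ × ℤ

QPoint : Set
QPoint = ℚ × ℚ

toℚ : ℤ → ℚ
toℚ z = z ℚ./ 1

toQPoint : Point → QPoint
toQPoint (x , y) = toℚ x , toℚ y

OnSegment : QPoint → Point → Point → Set
OnSegment (px , py) (ax , ay) (bx , by) =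
  ∃[ t ] (0ℚ ℚ.≤ t × t ℚ.≤ 1ℚ
         × px ≡ toℚ ax ℚ.+ t ℚ.* (toℚ bx ℚ.- toℚ ax)
         × py ≡ toℚ ay ℚ.+ t ℚ.* (toℚ by ℚ.- toℚ ay))

SamePair : ∀ {n} → Fin n → Fin n → Fin n → Fin n → Set
SamePair u v x y = (u ≡ x × v ≡ y) ⊎ (u ≡ y × v ≡ x)

-- Planar straight-line drawing with vertices at integer coordinates:
-- distinct vertices at distinct points, and two distinct edges share no
-- point except a common endpoint. (Intersections of segments with integer
-- endpoints are detected at rational points, so testing rational points
-- is exact.)
record IsPlanarDrawing {n : ℕ} (G : Graph n) (pos : Fin n → Point) : Set where
  open Graph G
  field
    injective : Injective _≡_ _≡_ pos
    noCrossing : ∀ u v x y → Edge u v → Edge x y → ¬ SamePair u v x y →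
      ∀ (p : QPoint) → OnSegment p (pos u) (pos v) → OnSegment p (pos x) (pos y) →
      ∃[ w ] ((w ≡ u ⊎ w ≡ v) × (w ≡ x ⊎ w ≡ y) × p ≡ toQPoint (pos w))

InClosedRect : Point → Point → Point → Set
InClosedRect (qx , qy) (ax , ay) (bx , by) =
  (ax ℤ.⊓ bx ℤ.≤ qx × qx ℤ.≤ ax ℤ.⊔ bx) × (ay ℤ.⊓ by ℤ.≤ qy × qy ℤ.≤ ay ℤ.⊔ by)

record IsClosedRIDrawing {n : ℕ} (G : Graph n) (pos : Fin n → Point) : Set where
  open Graph G
  field
    planar : IsPlanarDrawing G pos
    emptyRect : ∀ u v → Edge u v → ∀ w → w ≢ u → w ≢ v →
      ¬ InClosedRect (pos w) (pos u) (pos v)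

-- Maximum / minimum of finitely many integers (value 0 for an empty
-- family; only used for n ≥ 3 here).
maxOver : ∀ n → (Fin n → ℤ) → ℤ
maxOver zero f = ℤ.0ℤ
maxOver (suc zero) f = f Fin.zero
maxOver (suc (suc n)) f = f Fin.zero ℤ.⊔ maxOver (suc n) (λ i → f (Fin.suc i))

minOver : ∀ n → (Fin n → ℤ) → ℤ
minOver zero f = ℤ.0ℤ
minOver (suc zero) f = f Fin.zero
minOver (suc (suc n)) f = f Fin.zero ℤ.⊓ minOver (suc n) (λ i → f (Fin.suc i))

-- Grid size W × H of a drawing: the minimum bounding box has side lengths
-- W - 1 and H - 1.
gridWidth : ∀ n → (Fin n → Point) → ℕ
gridWidth n pos =
  suc ℤ.∣ maxOver n (λ i → proj₁ (pos i)) ℤ.- minOver n (λ i → proj₁ (pos i)) ∣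

gridHeight : ∀ n → (Fin n → Point) → ℕ
gridHeight n pos =
  suc ℤ.∣ maxOver n (λ i → proj₂ (pos i)) ℤ.- minOver n (λ i → proj₂ (pos i)) ∣

-- In a closed RI drawing of a star, a vertical line contains at most three
-- vertices: the closed rectangle spanned by the centre and a leaf v contains
-- no other vertex, so no other leaf w can lie on v's vertical line on the same
-- side (strictly above, level with, or strictly below) of the centre as v.
-- Hence n ≤ 3W, and symmetrically n ≤ 3H, so n² ≤ 9WH.
module Submission where

open import Defs
open import Data.Nat using (ℕ; _≤_; _*_)
open import Data.Fin using (Fin)
open import Data.Product using (Σ; _×_)

open import Algebra.Bundles using (AbelianGroup)
open import Data.Empty using (⊥-elim)
open import Data.Fin using (zero; suc; fromℕ<; combine; _≟_)
import Data.Fin.Properties as Finₚ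
open import Data.Integer as ℤ using (ℤ; _⊓_; _⊔_; _-_; +_; ∣_∣)
import Data.Integer.Properties as ℤₚ
open import Data.Nat as ℕ using (suc; s≤s; z≤n)
import Data.Nat.Properties as ℕₚ
open import Data.Nat.Solver using (module +-*-Solver)
open import Data.Product using (_,_; proj₁; proj₂)
open import Data.Sum using (_⊎_; inj₁; inj₂; reduce)
open import Relation.Binary.Definitions using (tri<; tri≈; tri>)
open import Relation.Binary.PropositionalEquality
open import Relation.Nullary using (yes; no)

open import Algebra.Properties.Group (AbelianGroup.group ℤₚ.+-0-abelianGroup)
  using (∙-cancelʳ)

InClosedInterval : ℤ → ℤ → ℤ → Set
InClosedInterval q a b = a ⊓ b ℤ.≤ q × q ℤ.≤ a ⊔ b

∈-interval-ascending : ∀ {q a b} → a ℤ.≤ q → q ℤ.≤ b → InClosedInterval q a b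
∈-interval-ascending a≤q q≤b =
  ℤₚ.≤-trans (ℤₚ.i⊓j≤i _ _) a≤q , ℤₚ.≤-trans q≤b (ℤₚ.i≤j⊔i _ _)

∈-interval-descending : ∀ {q a b} → b ℤ.≤ q → q ℤ.≤ a → InClosedInterval q a b
∈-interval-descending b≤q q≤a =
  ℤₚ.≤-trans (ℤₚ.i⊓j≤j _ _) b≤q , ℤₚ.≤-trans q≤a (ℤₚ.i≤i⊔j _ _)

∈-interval-right : ∀ a b → InClosedInterval b a b
∈-interval-right a b = ℤₚ.i⊓j≤j a b , ℤₚ.i≤j⊔i a b

∈-degenerate-interval : ∀ {q a} → InClosedInterval q a a → q ≡ a
∈-degenerate-interval {q} {a} (a⊓a≤q , q≤a⊔a) = ℤₚ.≤-antisym
  (subst (q ℤ.≤_) (ℤₚ.⊔-idem a) q≤a⊔a)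
  (subst (ℤ._≤ q) (ℤₚ.⊓-idem a) a⊓a≤q)

side : ℤ → ℤ → Fin 3
side c a with ℤₚ.<-cmp a c
... | tri< _ _ _ = zero
... | tri≈ _ _ _ = suc zero
... | tri> _ _ _ = suc (suc zero)

side-self : ∀ c → side c c ≡ suc zero
side-self c with ℤₚ.<-cmp c c
... | tri< c<c _ _ = ⊥-elim (ℤₚ.<-irrefl refl c<c)
... | tri≈ _ _ _   = refl
... | tri> _ _ c<c = ⊥-elim (ℤₚ.<-irrefl refl c<c)

side-level⇒≡ : ∀ c a → side c a ≡ suc zero → a ≡ c
side-level⇒≡ c a eq with ℤₚ.<-cmp a c
side-level⇒≡ c a () | tri< _ _ _
side-level⇒≡ c a _  | tri≈ _ a≡c _ = a≡c
side-level⇒≡ c a () | tri> _ _ _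

same-side⇒nested : ∀ c a b → side c a ≡ side c b →
                   InClosedInterval b c a ⊎ InClosedInterval a c b
same-side⇒nested c a b eq with ℤₚ.<-cmp a c | ℤₚ.<-cmp b c
... | tri< a<c _ _ | tri< b<c _ _ with ℤₚ.≤-total a b
...   | inj₁ a≤b = inj₁ (∈-interval-descending a≤b (ℤₚ.<⇒≤ b<c))
...   | inj₂ b≤a = inj₂ (∈-interval-descending b≤a (ℤₚ.<⇒≤ a<c))
same-side⇒nested c a b eq | tri≈ _ refl _ | tri≈ _ refl _ = inj₁ (∈-interval-right c c)
same-side⇒nested c a b eq | tri> _ _ c<a | tri> _ _ c<b with ℤₚ.≤-total a b
...   | inj₁ a≤b = inj₂ (∈-interval-ascending (ℤₚ.<⇒≤ c<a) a≤b)
...   | inj₂ b≤a = inj₁ (∈-interval-ascending (ℤₚ.<⇒≤ c<b) b≤a)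
same-side⇒nested c a b () | tri< _ _ _ | tri≈ _ _ _
same-side⇒nested c a b () | tri< _ _ _ | tri> _ _ _
same-side⇒nested c a b () | tri≈ _ _ _ | tri< _ _ _
same-side⇒nested c a b () | tri≈ _ _ _ | tri> _ _ _
same-side⇒nested c a b () | tri> _ _ _ | tri< _ _ _
same-side⇒nested c a b () | tri> _ _ _ | tri≈ _ _ _

span : ∀ n → (Fin n → ℤ) → ℕ
span n f = suc ∣ maxOver n f - minOver n f ∣

minOver-≤ : ∀ m (f : Fin (suc m) → ℤ) i → minOver (suc m) f ℤ.≤ f i
minOver-≤ ℕ.zero  f zero    = ℤₚ.≤-refl
minOver-≤ (suc m) f zero    = ℤₚ.i⊓j≤i _ _
minOver-≤ (suc m) f (suc i) =
  ℤₚ.≤-trans (ℤₚ.i⊓j≤j _ _) (minOver-≤ m (λ k → f (suc k)) i)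

≤-maxOver : ∀ m (f : Fin (suc m) → ℤ) i → f i ℤ.≤ maxOver (suc m) f
≤-maxOver ℕ.zero  f zero    = ℤₚ.≤-refl
≤-maxOver (suc m) f zero    = ℤₚ.i≤i⊔j _ _
≤-maxOver (suc m) f (suc i) =
  ℤₚ.≤-trans (≤-maxOver m (λ k → f (suc k)) i) (ℤₚ.i≤j⊔i _ _)

∣∣-mono-≤-nonneg : ∀ {i j} → ℤ.0ℤ ℤ.≤ i → i ℤ.≤ j → ∣ i ∣ ℕ.≤ ∣ j ∣
∣∣-mono-≤-nonneg (ℤ.+≤+ _) (ℤ.+≤+ m≤n) = m≤n

module _ {m} (f : Fin (suc m) → ℤ) where

  private
    low : ℤ
    low = minOver (suc m) f

    low≤f-low : ∀ i → ℤ.0ℤ ℤ.≤ f i - low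
    low≤f-low i = ℤₚ.i≤j⇒0≤j-i (minOver-≤ m f i)

  offset : Fin (suc m) → Fin (span (suc m) f)
  offset i = fromℕ< (s≤s (∣∣-mono-≤-nonneg (low≤f-low i)
    (ℤₚ.+-monoˡ-≤ (ℤ.- low) (≤-maxOver m f i))))

  offset-injective : ∀ {i j} → offset i ≡ offset j → f i ≡ f j
  offset-injective {i} {j} eq = ∙-cancelʳ (ℤ.- low) (f i) (f j) (begin
    f i - low         ≡⟨ ℤₚ.0≤i⇒+∣i∣≡i (low≤f-low i) ⟨
    + ∣ f i - low ∣   ≡⟨ cong +_ (Finₚ.fromℕ<-injective _ _ _ _ eq) ⟩
    + ∣ f j - low ∣   ≡⟨ ℤₚ.0≤i⇒+∣i∣≡i (low≤f-low j) ⟩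
    f j - low         ∎)
    where open ≡-Reasoning

  pairing-injective⇒≤-span* : ∀ {k} (t : Fin (suc m) → Fin k) →
    (∀ i j → f i ≡ f j → t i ≡ t j → i ≡ j) → suc m ≤ span (suc m) f * k
  pairing-injective⇒≤-span* t separates = Finₚ.injective⇒≤ code-injective
    where
    code : Fin (suc m) → Fin (span (suc m) f * _)
    code i = combine (offset i) (t i)

    code-injective : ∀ {i j} → code i ≡ code j → i ≡ j
    code-injective {i} {j} eq = separates i j
      (offset-injective (Finₚ.combine-injectiveˡ (offset i) (t i) (offset j) (t j) eq))
      (Finₚ.combine-injectiveʳ (offset i) (t i) (offset j) (t j) eq)

-- Vertex zero is the centre; for i = zero the rectangle degenerates to the
-- centre's point, so this also rules out a vertex sharing the centre's position.
CentreRectanglesEmpty : ∀ {m} → (X Y : Fin (suc m) → ℤ) → Set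
CentreRectanglesEmpty X Y = ∀ i j →
  InClosedInterval (X j) (X zero) (X i) → InClosedInterval (Y j) (Y zero) (Y i) →
  j ≡ zero ⊎ j ≡ i

CentreRectanglesEmpty-swap : ∀ {m} {X Y : Fin (suc m) → ℤ} →
  CentreRectanglesEmpty X Y → CentreRectanglesEmpty Y X
CentreRectanglesEmpty-swap empty i j y∈ x∈ = empty i j x∈ y∈

closedRI-star⇒centreRectanglesEmpty : ∀ {m} {pos : Fin (suc m) → Point} →
  IsClosedRIDrawing (Star (suc m)) pos →
  CentreRectanglesEmpty (λ i → proj₁ (pos i)) (λ i → proj₂ (pos i))
closedRI-star⇒centreRectanglesEmpty d zero j x∈ y∈ =
  inj₁ (injective (cong₂ _,_ (∈-degenerate-interval x∈) (∈-degenerate-interval y∈)))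
  where open IsPlanarDrawing (IsClosedRIDrawing.planar d)
closedRI-star⇒centreRectanglesEmpty d (suc v) j x∈ y∈ with j ≟ zero | j ≟ suc v
... | yes j≡0 | _        = inj₁ j≡0
... | no _    | yes j≡v  = inj₂ j≡v
... | no j≢0  | no j≢v   =
  ⊥-elim (IsClosedRIDrawing.emptyRect d zero (suc v) (inj₁ (refl , λ ())) j j≢0 j≢v (x∈ , y∈))

module _ {m} {X Y : Fin (suc m) → ℤ} (empty : CentreRectanglesEmpty X Y) where

  private
    ySide : Fin (suc m) → Fin 3
    ySide i = side (Y zero) (Y i)

    same-column : ∀ {i j} → X i ≡ X j → InClosedInterval (X j) (X zero) (X i)
    same-column {i} eq = subst (λ x → InClosedInterval x (X zero) (X i)) eq
      (∈-interval-right (X zero) (X i))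

    nested⇒≡ : ∀ i j → X i ≡ X j → ySide i ≡ ySide j →
               InClosedInterval (Y j) (Y zero) (Y i) → i ≡ j
    nested⇒≡ i j x≡ s≡ y∈ with empty i j (same-column x≡) y∈
    ... | inj₂ j≡i = sym j≡i
    ... | inj₁ refl = reduce (empty zero i (same-column (sym x≡))
      (subst (λ y → InClosedInterval y (Y zero) (Y zero))
        (sym (side-level⇒≡ (Y zero) (Y i) (trans s≡ (side-self (Y zero)))))
        (∈-interval-right (Y zero) (Y zero))))

  ySide-separates-columns : ∀ i j → X i ≡ X j → ySide i ≡ ySide j → i ≡ j
  ySide-separates-columns i j x≡ s≡ with same-side⇒nested (Y zero) (Y i) (Y j) s≡
  ... | inj₁ yj∈ = nested⇒≡ i j x≡ s≡ yj∈
  ... | inj₂ yi∈ = sym (nested⇒≡ j i (sym x≡) (sym s≡) yi∈)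

  ≤-span*3 : suc m ≤ span (suc m) X * 3
  ≤-span*3 = pairing-injective⇒≤-span* X ySide ySide-separates-columns

corollary8 : Σ ℕ (λ k → (1 ≤ k) × ((n : ℕ) → 3 ≤ n → (pos : Fin n → Point) →
               IsClosedRIDrawing (Star n) pos →
               n * n ≤ k * (gridWidth n pos * gridHeight n pos)))
corollary8 = 9 , s≤s z≤n , bound
  where
  rearrange : ∀ w h → w * 3 * (h * 3) ≡ 9 * (w * h)
  rearrange = solve 2 (λ w h → w :* con 3 :* (h :* con 3) := con 9 :* (w :* h)) refl
    where open +-*-Solver

  bound : (n : ℕ) → 3 ≤ n → (pos : Fin n → Point) → IsClosedRIDrawing (Star n) pos →
          n * n ≤ 9 * (gridWidth n pos * gridHeight n pos)
  bound (suc m) _ pos d = subst (suc m * suc m ≤_)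
    (rearrange (gridWidth (suc m) pos) (gridHeight (suc m) pos))
    (ℕₚ.*-mono-≤ (≤-span*3 empty) (≤-span*3 (CentreRectanglesEmpty-swap empty)))
    where
    empty : CentreRectanglesEmpty (λ i → proj₁ (pos i)) (λ i → proj₂ (pos i))
    empty = closedRI-star⇒centreRectanglesEmpty d
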